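{- CPM($\gamma$) satisfies Standard Consistency, and therefore also Refinement Consistency.
   Context: The input is a simple unweighted undirected graph $N=(V,E)$. For a clustering $\mathcal{C}$ (a partition of $V$), with $e_c$ the number of edges inside cluster $c$ and $n_c$ the number of nodes of $c$, the CPM score is $\mathcal{H}=\sum_{c\in\mathcal{C}}\left[e_c-\gamma\binom{n_c}{2}\right]$. CPM($\gamma$) is the clustering method that returns a clustering maximizing this score, where the resolution parameter $\gamma$ is fixed but arbitrary with $0<\gamma<1$. A clustering method $M$ satisfies Standard Consistency if, for every graph $N=(V,E)$ and output clustering $M(N)$, whenever $E'$ differs from $E$ by removing edges between different clusters of $M(N)$ and/or adding edges within clusters of $M(N)$, we have $M(N')=M(N)$ for $N'=(V,E')$. Refinement Consistency is the relaxation of Standard Consistency in which adding edges internal to a cluster is allowed to split that cluster apart, but no other changes are allowed. (It was previously shown that CPM($\gamma$) satisfies Inter-edge Consistency: an optimal clustering remains optimal when edges between different clusters are removed.)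
   Formalization: The resolution parameter γ is taken over the rationals, with $0<\gamma<1$. -}

module Defs where

open import Data.Bool using (Bool; true; false; T)
open import Data.Nat using (ℕ; zero; suc) renaming (_+_ to _+ℕ_)
open import Data.Nat.Combinatorics using (_C_)
open import Data.Fin using (Fin; zero; suc) renaming (_<_ to _<ᶠ_)
open import Data.Fin.Properties using (_<?_) renaming (_≟_ to _≟ᶠ_)
open import Data.Integer using (+_)
open import Data.Rational using (ℚ; 0ℚ; _+_; _-_; _*_; _/_; _≤_)
open import Data.Product using (Σ; _×_)
open import Relation.Binary.PropositionalEquality using (_≡_)
open import Relation.Nullary using (¬_; yes; no)

record Graph (n : ℕ) : Set where
  field
    adj     : Fin n → Fin n → Bool
    symm    : ∀ i j → adj i j ≡ adj j i
    irrefl  : ∀ i → adj i i ≡ false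
open Graph public

-- A clustering (partition of V = Fin n) given by a cluster label for each
-- vertex; two vertices are in the same cluster iff they have the same label.
-- At most n clusters exist, so labels in Fin n suffice (empty labels are
-- not clusters and contribute 0 to the score).
Clustering : ℕ → Set
Clustering n = Fin n → Fin n

sumℕ : ∀ {n} → (Fin n → ℕ) → ℕ
sumℕ {zero}  f = 0
sumℕ {suc n} f = f zero +ℕ sumℕ (λ i → f (suc i))

sumℚ : ∀ {n} → (Fin n → ℚ) → ℚ
sumℚ {zero}  f = 0ℚ
sumℚ {suc n} f = f zero + sumℚ (λ i → f (suc i))

ℕtoℚ : ℕ → ℚ
ℕtoℚ k = + k / 1

inC : ∀ {n} → Clustering n → Fin n → Fin n → ℕ
inC 𝒞 c i with 𝒞 i ≟ᶠ c
... | yes _ = 1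
... | no  _ = 0

clusterSize : ∀ {n} → Clustering n → Fin n → ℕ
clusterSize 𝒞 c = sumℕ (inC 𝒞 c)

edgeInC : ∀ {n} → Graph n → Clustering n → Fin n → Fin n → Fin n → ℕ
edgeInC G 𝒞 c i j with i <? j | adj G i j | 𝒞 i ≟ᶠ c | 𝒞 j ≟ᶠ c
... | yes _ | true | yes _ | yes _ = 1
... | _     | _    | _     | _     = 0

clusterEdges : ∀ {n} → Graph n → Clustering n → Fin n → ℕ
clusterEdges G 𝒞 c = sumℕ (λ i → sumℕ (λ j → edgeInC G 𝒞 c i j))

cpmScore : ∀ {n} → ℚ → Graph n → Clustering n → ℚ
cpmScore γ G 𝒞 =
  sumℚ (λ c → ℕtoℚ (clusterEdges G 𝒞 c) - γ * ℕtoℚ (clusterSize 𝒞 c C 2))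

CPMOptimal : ∀ {n} → ℚ → Graph n → Clustering n → Set
CPMOptimal γ G 𝒞 = ∀ (D : Clustering _) → cpmScore γ G D ≤ cpmScore γ G 𝒞

AllowedChange : ∀ {n} → Clustering n → Graph n → Graph n → Set
AllowedChange 𝒞 G G' =
  ∀ i j → (𝒞 i ≡ 𝒞 j → T (adj G i j) → T (adj G' i j))
        × (¬ (𝒞 i ≡ 𝒞 j) → T (adj G' i j) → T (adj G i j))

Refines : ∀ {n} → Clustering n → Clustering n → Set
Refines D 𝒞 = ∀ i j → D i ≡ D j → 𝒞 i ≡ 𝒞 j

-- Standard Consistency of CPM(γ) (CPM is set-valued because of ties:
-- every optimal clustering of N stays optimal for N')
StandardConsistencyCPM : ℚ → Set
StandardConsistencyCPM γ =
  ∀ (n : ℕ) (G G' : Graph n) (𝒞 : Clustering n) →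
    CPMOptimal γ G 𝒞 → AllowedChange 𝒞 G G' → CPMOptimal γ G' 𝒞

RefinementConsistencyCPM : ℚ → Set
RefinementConsistencyCPM γ =
  ∀ (n : ℕ) (G G' : Graph n) (𝒞 : Clustering n) →
    CPMOptimal γ G 𝒞 → AllowedChange 𝒞 G G' →
    Σ (Clustering n) (λ D → CPMOptimal γ G' D × Refines D 𝒞)

-- The CPM score of a clustering D is the number of edges inside clusters of
-- D minus a penalty depending only on the cluster sizes of D, not on the
-- graph. An edge added inside a cluster of 𝒞 counts for 𝒞 and at most for
-- D; an edge removed between clusters of 𝒞 never counted for 𝒞. So each
-- allowed change raises the score of 𝒞 at least as much as that of any D,
-- and an optimal 𝒞 stays optimal.
module Submission where

open import Defs
open import Data.Bool using (Bool; true; false; T; _∧_)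
open import Data.Empty using (⊥-elim)
open import Data.Fin using (Fin; zero; suc)
open import Data.Fin.Properties using (_<?_) renaming (_≟_ to _≟ᶠ_)
import Data.Integer as ℤ
import Data.Integer.Properties as ℤ
open import Data.Nat using (ℕ; zero; suc; _+_; _*_; _≤_; z≤n)
open import Data.Nat.Combinatorics using (_C_)
open import Data.Nat.Coprimality using (1-coprimeTo) renaming (sym to coprime-sym)
open import Data.Nat.Properties using (≤-refl; +-identityʳ; +-mono-≤; *-zeroʳ; *-distribˡ-+)
open import Data.Nat.Tactic.RingSolver using (solve-∀)
open import Data.Product using (_×_; _,_; proj₁; proj₂)
open import Data.Rational as ℚ using (ℚ; 0ℚ; 1ℚ; mkℚ; _<_; -_)
open import Data.Rational.Properties as ℚ using (normalize-coprime; /-cong)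
open import Data.Rational.Solver using (module +-*-Solver)
open import Relation.Binary.PropositionalEquality
open import Relation.Nullary using (¬_; Dec; yes; no)
open import Relation.Nullary.Decidable using (does; ⌊_⌋)

open +-*-Solver

toℕ : Bool → ℕ
toℕ true  = 1
toℕ false = 0

toℕ-∧ : ∀ x y → toℕ (x ∧ y) ≡ toℕ x * toℕ y
toℕ-∧ true  y = sym (+-identityʳ (toℕ y))
toℕ-∧ false y = refl

δ : ∀ {n} → Fin n → Fin n → ℕ
δ a c = toℕ (does (a ≟ᶠ c))

sumℕ-cong : ∀ {n} {f g : Fin n → ℕ} → (∀ i → f i ≡ g i) → sumℕ f ≡ sumℕ g
sumℕ-cong {zero}  f≗g = refl
sumℕ-cong {suc n} f≗g = cong₂ _+_ (f≗g zero) (sumℕ-cong (λ i → f≗g (suc i)))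

sumℕ-zero : ∀ {n} → sumℕ {n} (λ _ → 0) ≡ 0
sumℕ-zero {zero}  = refl
sumℕ-zero {suc n} = sumℕ-zero {n}

sumℕ-distrib-+ : ∀ {n} (f g : Fin n → ℕ) →
  sumℕ (λ i → f i + g i) ≡ sumℕ f + sumℕ g
sumℕ-distrib-+ {zero}  f g = refl
sumℕ-distrib-+ {suc n} f g = trans
  (cong (f zero + g zero +_) (sumℕ-distrib-+ (λ i → f (suc i)) (λ i → g (suc i))))
  (+-+-swap (f zero) (g zero) _ _)
  where
  +-+-swap : ∀ a b c d → a + b + (c + d) ≡ a + c + (b + d)
  +-+-swap = solve-∀

sumℕ-comm : ∀ {m n} (f : Fin m → Fin n → ℕ) →
  sumℕ (λ i → sumℕ (λ j → f i j)) ≡ sumℕ (λ j → sumℕ (λ i → f i j))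
sumℕ-comm {zero}  {n} f = sym (sumℕ-zero {n})
sumℕ-comm {suc m}     f = trans (cong (sumℕ (f zero) +_) (sumℕ-comm (λ i → f (suc i))))
  (sym (sumℕ-distrib-+ (f zero) _))

*-distribˡ-sumℕ : ∀ {n} k (f : Fin n → ℕ) → k * sumℕ f ≡ sumℕ (λ i → k * f i)
*-distribˡ-sumℕ {zero}  k f = *-zeroʳ k
*-distribˡ-sumℕ {suc n} k f = trans (*-distribˡ-+ k (f zero) _)
  (cong (k * f zero +_) (*-distribˡ-sumℕ k (λ i → f (suc i))))

sumℕ-mono : ∀ {n} {f g : Fin n → ℕ} → (∀ i → f i ≤ g i) → sumℕ f ≤ sumℕ g
sumℕ-mono {zero}  f≤g = z≤n
sumℕ-mono {suc n} f≤g = +-mono-≤ (f≤g zero) (sumℕ-mono (λ i → f≤g (suc i)))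

sumℕ-mono-+ : ∀ {n} {f g h k : Fin n → ℕ} → (∀ i → f i + g i ≤ h i + k i) →
  sumℕ f + sumℕ g ≤ sumℕ h + sumℕ k
sumℕ-mono-+ {f = f} {g} {h} {k} pointwise =
  subst₂ _≤_ (sumℕ-distrib-+ f g) (sumℕ-distrib-+ h k) (sumℕ-mono pointwise)

-- `suc a ≟ᶠ suc c` has the same `does` as `a ≟ᶠ c`, so the successor case is
-- the induction hypothesis on the nose.
sumℕ-δ : ∀ {n} (a : Fin n) (f : Fin n → ℕ) → sumℕ (λ c → δ a c * f c) ≡ f a
sumℕ-δ {suc n} zero f = trans (cong₂ _+_ (+-identityʳ (f zero)) (sumℕ-zero {n})) (+-identityʳ (f zero))
sumℕ-δ {suc n} (suc a) f = sumℕ-δ a (λ c → f (suc c))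

-- `does (i <? j)` would unfold to a `<ᵇ` test that `with i <? j` cannot
-- abstract in edgeInC-δ; `⌊ i <? j ⌋` stays folded.
intraEdge : ∀ {n} → Graph n → Clustering n → Fin n → Fin n → Bool
intraEdge G D i j = (⌊ i <? j ⌋ ∧ adj G i j) ∧ does (D i ≟ᶠ D j)

intraEdges : ∀ {n} → Graph n → Clustering n → ℕ
intraEdges G D = sumℕ (λ i → sumℕ (λ j → toℕ (intraEdge G D i j)))

edgeInC-δ : ∀ {n} (G : Graph n) (D : Clustering n) c i j →
  edgeInC G D c i j ≡ toℕ (⌊ i <? j ⌋ ∧ adj G i j) * (δ (D j) c * δ (D i) c)
edgeInC-δ G D c i j with i <? j | adj G i j | D i ≟ᶠ c | D j ≟ᶠ c
... | yes _ | true  | yes _ | yes _ = refl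
... | yes _ | true  | yes _ | no _  = refl
... | yes _ | true  | no _  | yes _ = refl
... | yes _ | true  | no _  | no _  = refl
... | yes _ | false | _     | _     = refl
... | no _  | _     | _     | _     = refl

sumℕ-edgeInC : ∀ {n} (G : Graph n) (D : Clustering n) i j →
  sumℕ (λ c → edgeInC G D c i j) ≡ toℕ (intraEdge G D i j)
sumℕ-edgeInC G D i j = begin
  sumℕ (λ c → edgeInC G D c i j)                  ≡⟨ sumℕ-cong (λ c → edgeInC-δ G D c i j) ⟩
  sumℕ (λ c → toℕ p * (δ (D j) c * δ (D i) c))   ≡⟨ sym (*-distribˡ-sumℕ (toℕ p) (λ c → δ (D j) c * δ (D i) c)) ⟩
  toℕ p * sumℕ (λ c → δ (D j) c * δ (D i) c)     ≡⟨ cong (toℕ p *_) (sumℕ-δ (D j) (δ (D i))) ⟩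
  toℕ p * δ (D i) (D j)                          ≡⟨ sym (toℕ-∧ p _) ⟩
  toℕ (intraEdge G D i j)                        ∎
  where
  open ≡-Reasoning
  p = ⌊ i <? j ⌋ ∧ adj G i j

sumℕ-clusterEdges : ∀ {n} (G : Graph n) (D : Clustering n) →
  sumℕ (clusterEdges G D) ≡ intraEdges G D
sumℕ-clusterEdges G D = begin
  sumℕ (λ c → sumℕ (λ i → sumℕ (λ j → edgeInC G D c i j)))
    ≡⟨ sumℕ-comm (λ c i → sumℕ (λ j → edgeInC G D c i j)) ⟩
  sumℕ (λ i → sumℕ (λ c → sumℕ (λ j → edgeInC G D c i j)))
    ≡⟨ sumℕ-cong (λ i → sumℕ-comm (λ c j → edgeInC G D c i j)) ⟩
  sumℕ (λ i → sumℕ (λ j → sumℕ (λ c → edgeInC G D c i j)))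
    ≡⟨ sumℕ-cong (λ i → sumℕ-cong (sumℕ-edgeInC G D i)) ⟩
  intraEdges G D ∎
  where open ≡-Reasoning

∧-monoʳ-T : ∀ l {a a′} → (T a → T a′) → T (l ∧ a) → T (l ∧ a′)
∧-monoʳ-T true  a⇒a′ = a⇒a′
∧-monoʳ-T false a⇒a′ = λ ()

toℕ-∧-exchange : ∀ {P : Set} (y : Dec P) e e′ x → (P → T e → T e′) → (¬ P → T e′ → T e) →
  toℕ (e′ ∧ x) + toℕ (e ∧ does y) ≤ toℕ (e ∧ x) + toℕ (e′ ∧ does y)
toℕ-∧-exchange y       true  true  x     _     _      = ≤-refl
toℕ-∧-exchange y       false false x     _     _      = ≤-refl
toℕ-∧-exchange (yes p) true  false x     kept  _      = ⊥-elim (kept p _)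
toℕ-∧-exchange (no ¬p) true  false x     _     _      = z≤n
toℕ-∧-exchange (yes p) false true  false _     _      = z≤n
toℕ-∧-exchange (yes p) false true  true  _     _      = ≤-refl
toℕ-∧-exchange (no ¬p) false true  x     _     absent = ⊥-elim (absent ¬p _)

intraEdges-exchange : ∀ {n} (G G′ : Graph n) (𝒞 D : Clustering n) → AllowedChange 𝒞 G G′ →
  intraEdges G′ D + intraEdges G 𝒞 ≤ intraEdges G D + intraEdges G′ 𝒞
intraEdges-exchange G G′ 𝒞 D allowed =
  sumℕ-mono-+ (λ i → sumℕ-mono-+ (λ j →
    toℕ-∧-exchange (𝒞 i ≟ᶠ 𝒞 j) (⌊ i <? j ⌋ ∧ adj G i j) (⌊ i <? j ⌋ ∧ adj G′ i j) (does (D i ≟ᶠ D j))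
      (λ same → ∧-monoʳ-T ⌊ i <? j ⌋ (proj₁ (allowed i j) same))
      (λ differ → ∧-monoʳ-T ⌊ i <? j ⌋ (proj₂ (allowed i j) differ))))

ℕtoℚ-mkℚ : ∀ k → ℕtoℚ k ≡ mkℚ (ℤ.+ k) 0 (coprime-sym (1-coprimeTo k))
ℕtoℚ-mkℚ k = normalize-coprime (coprime-sym (1-coprimeTo k))

ℕtoℚ-+ : ∀ m n → ℕtoℚ (m + n) ≡ ℕtoℚ m ℚ.+ ℕtoℚ n
ℕtoℚ-+ m n rewrite ℕtoℚ-mkℚ m | ℕtoℚ-mkℚ n =
  sym (/-cong (cong₂ ℤ._+_ (ℤ.*-identityʳ (ℤ.+ m)) (ℤ.*-identityʳ (ℤ.+ n))) refl)

ℕtoℚ-mono-≤ : ∀ {m n} → m ≤ n → ℕtoℚ m ℚ.≤ ℕtoℚ n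
ℕtoℚ-mono-≤ {m} {n} m≤n rewrite ℕtoℚ-mkℚ m | ℕtoℚ-mkℚ n =
  ℚ.*≤* (subst₂ ℤ._≤_ (sym (ℤ.*-identityʳ (ℤ.+ m))) (sym (ℤ.*-identityʳ (ℤ.+ n))) (ℤ.+≤+ m≤n))

ℕtoℚ-+-mono-≤ : ∀ a b c d → a + b ≤ c + d → ℕtoℚ a ℚ.+ ℕtoℚ b ℚ.≤ ℕtoℚ c ℚ.+ ℕtoℚ d
ℕtoℚ-+-mono-≤ a b c d ab≤cd = subst₂ ℚ._≤_ (ℕtoℚ-+ a b) (ℕtoℚ-+ c d) (ℕtoℚ-mono-≤ ab≤cd)

sumℚ-ℕtoℚ-sub : ∀ {n} (f : Fin n → ℕ) (g : Fin n → ℚ) →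
  sumℚ (λ c → ℕtoℚ (f c) ℚ.- g c) ≡ ℕtoℚ (sumℕ f) ℚ.- sumℚ g
sumℚ-ℕtoℚ-sub {zero}  f g = refl
sumℚ-ℕtoℚ-sub {suc n} f g = begin
  (ℕtoℚ (f zero) ℚ.- g zero) ℚ.+ sumℚ (λ c → ℕtoℚ (f (suc c)) ℚ.- g (suc c))
    ≡⟨ cong ((ℕtoℚ (f zero) ℚ.- g zero) ℚ.+_) (sumℚ-ℕtoℚ-sub (λ c → f (suc c)) (λ c → g (suc c))) ⟩
  (ℕtoℚ (f zero) ℚ.- g zero) ℚ.+ (ℕtoℚ (sumℕ (λ c → f (suc c))) ℚ.- sumℚ (λ c → g (suc c)))
    ≡⟨ solve 4 (λ x y z w → (x :- y) :+ (z :- w) := (x :+ z) :- (y :+ w)) refl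
         (ℕtoℚ (f zero)) (g zero) (ℕtoℚ (sumℕ (λ c → f (suc c)))) (sumℚ (λ c → g (suc c))) ⟩
  (ℕtoℚ (f zero) ℚ.+ ℕtoℚ (sumℕ (λ c → f (suc c)))) ℚ.- sumℚ g
    ≡⟨ cong (ℚ._- sumℚ g) (sym (ℕtoℚ-+ (f zero) _)) ⟩
  ℕtoℚ (sumℕ f) ℚ.- sumℚ g ∎
  where open ≡-Reasoning

≤-transfer : ∀ a b c d p q → a ℚ.+ b ℚ.≤ c ℚ.+ d → c ℚ.- p ℚ.≤ b ℚ.- q → a ℚ.- p ℚ.≤ d ℚ.- q
≤-transfer a b c d p q ab≤cd cp≤bq =
  subst₂ ℚ._≤_ left right (ℚ.+-monoˡ-≤ (- (b ℚ.+ c)) (ℚ.+-mono-≤ ab≤cd cp≤bq))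
  where
  left : (a ℚ.+ b) ℚ.+ (c ℚ.- p) ℚ.+ - (b ℚ.+ c) ≡ a ℚ.- p
  left = solve 4 (λ a b c p → (a :+ b) :+ (c :- p) :+ :- (b :+ c) := a :- p) refl a b c p
  right : (c ℚ.+ d) ℚ.+ (b ℚ.- q) ℚ.+ - (b ℚ.+ c) ≡ d ℚ.- q
  right = solve 4 (λ b c d q → (c :+ d) :+ (b :- q) :+ :- (b :+ c) := d :- q) refl b c d q

penalty : ∀ {n} → ℚ → Clustering n → ℚ
penalty γ D = sumℚ (λ c → γ ℚ.* ℕtoℚ (clusterSize D c C 2))

cpmScore-≡ : ∀ {n} γ (G : Graph n) (D : Clustering n) →
  cpmScore γ G D ≡ ℕtoℚ (intraEdges G D) ℚ.- penalty γ D
cpmScore-≡ γ G D =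
  trans (sumℚ-ℕtoℚ-sub (clusterEdges G D) (λ c → γ ℚ.* ℕtoℚ (clusterSize D c C 2)))
        (cong (λ e → ℕtoℚ e ℚ.- penalty γ D) (sumℕ-clusterEdges G D))

cpm-standardConsistent : ∀ γ → StandardConsistencyCPM γ
cpm-standardConsistent γ n G G′ 𝒞 optimal allowed D =
  subst₂ ℚ._≤_ (sym (cpmScore-≡ γ G′ D)) (sym (cpmScore-≡ γ G′ 𝒞))
    (≤-transfer (e′ D) (e 𝒞) (e D) (e′ 𝒞) (penalty γ D) (penalty γ 𝒞) edgeGain optimalBefore)
  where
  e e′ : Clustering n → ℚ
  e  X = ℕtoℚ (intraEdges G X)
  e′ X = ℕtoℚ (intraEdges G′ X)
  edgeGain : e′ D ℚ.+ e 𝒞 ℚ.≤ e D ℚ.+ e′ 𝒞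
  edgeGain = ℕtoℚ-+-mono-≤ (intraEdges G′ D) (intraEdges G 𝒞) (intraEdges G D) (intraEdges G′ 𝒞)
    (intraEdges-exchange G G′ 𝒞 D allowed)
  optimalBefore : e D ℚ.- penalty γ D ℚ.≤ e 𝒞 ℚ.- penalty γ 𝒞
  optimalBefore = subst₂ ℚ._≤_ (cpmScore-≡ γ G D) (cpmScore-≡ γ G 𝒞) (optimal D)

cpm-refinementConsistent : ∀ γ → RefinementConsistencyCPM γ
cpm-refinementConsistent γ n G G′ 𝒞 optimal allowed =
  𝒞 , cpm-standardConsistent γ n G G′ 𝒞 optimal allowed , (λ i j same → same)

-- Neither property needs 0 < γ < 1.
lemma4 : (γ : ℚ) → 0ℚ < γ → γ < 1ℚ →
    StandardConsistencyCPM γ × RefinementConsistencyCPM γ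
lemma4 γ _ _ = cpm-standardConsistent γ , cpm-refinementConsistent γ
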